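{- Let $n\ge4$ and let $k$ be a positive integer with $k\le13$ and $k\notin\{1,8,11,12\}$. Set \[A=\left\lceil\frac{k+4}{4}\right\rceil,\qquad B=\left\lceil\frac{ -2+3A}{2}\right\rceil,\qquad C=k+4-3A.\] Then \[\gamma_{[k]R}(C_3\square P_n)\le 2(n-2)A+4B+2C\le\frac{nk+2k+8n+12}{2}.\]
   Context: $C_3$ is the cycle on 3 vertices, $P_n$ the path on $n$ vertices, and $\square$ the Cartesian product. For an integer $k\ge1$ and a labeling $f:V(G)\to\{0,1,\dots,k+1\}$, let $AN(v)=\{u\in N(v): f(u)>0\}$. The labeling $f$ is a $[k]$-Roman dominating function if every vertex $v$ with $f(v)<k$ satisfies $f(N[v])\ge k+|AN(v)|$, where $N[v]=N(v)\cup\{v\}$ and $f(X)=\sum_{x\in X}f(x)$. $\gamma_{[k]R}(G)$ is the minimum of $\sum_v f(v)$ over all $[k]$-Roman dominating functions $f$ on $G$. -}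

module Defs where

open import Data.Nat using (ℕ; zero; suc; _+_; _*_; _∸_; _≤_; _<_; _/_)
open import Data.Nat.Properties using (_≟_)
open import Data.Fin using (Fin; toℕ)
open import Data.Product using (_×_; _,_; ∃)
open import Data.Bool using (Bool; true; false; _∧_; _∨_; not; if_then_else_)
open import Data.List using (List; map; allFin; cartesianProduct)
open import Data.Nat.ListAction using (sum)
open import Relation.Nullary.Decidable using (⌊_⌋)
import Data.Integer as ℤ

-- A finite simple graph: a finite list enumerating its vertices
-- (each exactly once) and a Boolean adjacency relation.
record Graph : Set₁ where
  field
    V     : Set
    verts : List V
    adj   : V → V → Bool
open Graph public

eqℕ : ℕ → ℕ → Bool
eqℕ a b = ⌊ a ≟ b ⌋

-- Cycle C_m on vertex set Fin m: i ~ j iff j ≡ i ± 1 (mod m).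
-- For m = 3 this is the triangle K_3.
cycleAdj : (m : ℕ) → Fin m → Fin m → Bool
cycleAdj m i j =
  not (eqℕ (toℕ i) (toℕ j)) ∧
  (eqℕ (toℕ j) (suc (toℕ i)) ∨ eqℕ (toℕ i) (suc (toℕ j)) ∨
   (eqℕ (toℕ i) 0 ∧ eqℕ (suc (toℕ j)) m) ∨ (eqℕ (toℕ j) 0 ∧ eqℕ (suc (toℕ i)) m))

pathAdj : (n : ℕ) → Fin n → Fin n → Bool
pathAdj n i j = eqℕ (toℕ j) (suc (toℕ i)) ∨ eqℕ (toℕ i) (suc (toℕ j))

-- Cartesian product G □ H: (g,h) ~ (g',h') iff (g ~ g' and h = h') or (g = g' and h ~ h').
-- Equality on vertices is needed; we specialise to graphs on Fin (as C and P are).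
record FinGraph : Set where
  field
    size : ℕ
    fadj : Fin size → Fin size → Bool

eqFin : ∀ {m} → Fin m → Fin m → Bool
eqFin a b = eqℕ (toℕ a) (toℕ b)

_□_ : FinGraph → FinGraph → Graph
G □ H = record
  { V = Fin (FinGraph.size G) × Fin (FinGraph.size H)
  ; verts = cartesianProduct (allFin _) (allFin _)
  ; adj = λ { (g , h) (g' , h') →
        (FinGraph.fadj G g g' ∧ eqFin h h') ∨ (eqFin g g' ∧ FinGraph.fadj H h h') }
  }

Cf : ℕ → FinGraph
Cf m = record { size = m ; fadj = cycleAdj m }

Pf : ℕ → FinGraph
Pf n = record { size = n ; fadj = pathAdj n }

module _ (G : Graph) where
  private
    Vx = V G

  sumWhere : (Vx → Bool) → (Vx → ℕ) → ℕ
  sumWhere p w = sum (map (λ u → if p u then w u else 0) (verts G))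

  weight : (Vx → ℕ) → ℕ
  weight f = sum (map f (verts G))

  fClosedNbhd : (Vx → ℕ) → Vx → ℕ
  fClosedNbhd f v = f v + sumWhere (adj G v) f

  activeNbrs : (Vx → ℕ) → Vx → ℕ
  activeNbrs f v = sumWhere (λ u → adj G v u ∧ not (eqℕ (f u) 0)) (λ _ → 1)

  IsKRDF : ℕ → (Vx → ℕ) → Set
  IsKRDF k f =
    (∀ v → f v ≤ suc k) ×
    (∀ v → f v < k → k + activeNbrs f v ≤ fClosedNbhd f v)

  -- γ_{[k]R}(G) ≤ b  (γ is the minimum weight of a [k]-RDF)
  GammaKR≤ : ℕ → ℤ.ℤ → Set
  GammaKR≤ k b = ∃ λ f → IsKRDF k f × ℤ.+ (weight f) ℤ.≤ b

ceilDiv : ℕ → (b : ℕ) → ℕ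
ceilDiv a zero = 0
ceilDiv a (suc b) = (a + b) / suc b

-- Label C₃ □ Pₙ column by column, a column being a copy of C₃ = K₃. Each interior column
-- carries A on two vertices and 0 on the third, the 0 moving to the next row from one column
-- to the next; the two end columns carry 0, e₁, e₂ suitably rotated. The closed neighbourhood
-- of a vertex is its whole column plus the same row of the two adjacent columns, so with a
-- pattern of period 3 the [k]-Roman condition only has to be checked on finitely many windows
-- of three consecutive columns, which is done by evaluation for each k. The weight is
-- 2(n − 2)A + 2(e₁ + e₂), and e₁, e₂ are chosen with 2(e₁ + e₂) ≤ 4B + 2C.
module Submission where

open import Defs
open import Data.Nat using (ℕ; zero; suc; _+_; _*_; _∸_; _≤_; _<_; _≡ᵇ_; z≤n; s≤s)
open import Data.Integer using (+_; _-_)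
import Data.Integer as Z
import Data.Integer.Properties as Z
open import Data.Nat.Properties
  using ( _≟_; _≤?_; _<?_; +-identityʳ; +-assoc; +-comm; +-monoʳ-≤; +-mono-≤; *-monoʳ-≤
        ; m+n≤o⇒m≤o; n≮n; module ≤-Reasoning; +-0-commutativeMonoid)
open import Data.Nat.Tactic.RingSolver using (solve-∀)
open import Data.Nat.ListAction using (sum)
open import Data.Nat.ListAction.Properties using (sum-++)
open import Data.Bool using (true; false; _∧_; _∨_; not; if_then_else_)
open import Data.Bool.Properties using (∨-identityʳ)
open import Data.Fin using (Fin; toℕ; punchIn)
open import Data.Fin.Patterns using (0F; 1F; 2F)
import Data.Fin as Fin
open import Data.Fin.Properties using (toℕ-injective; toℕ<n; punchInᵢ≢i; all?)
open import Data.List using ([]; _∷_; _++_; map; allFin; cartesianProduct; tabulate)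
open import Data.List.Properties using (map-++; map-∘; map-tabulate; map-cong)
open import Data.Product using (_×_; _,_)
open import Function using (_∘_; id)
open import Relation.Binary.PropositionalEquality
  using (_≡_; _≢_; refl; sym; trans; cong; cong₂; subst; subst₂; module ≡-Reasoning)
open import Relation.Nullary.Negation using (contradiction)
open import Relation.Nullary.Decidable
  using (Dec; map′; from-yes; isYes≗does; dec-true; dec-false; _→-dec_; _×-dec_)
open import Algebra.Properties.CommutativeMonoid.Sum +-0-commutativeMonoid
  using (sum-syntax; sum-cong-≗; sum-replicate-zero; sum-remove; ∑-distrib-+; ∑-comm)

private
  variable
    A B : Set

infixr 5 _◂_
_◂_ : A → (ℕ → A) → ℕ → A
(x ◂ s) zero    = x
(x ◂ s) (suc j) = s j

sum-allFin : ∀ n (f : Fin n → ℕ) → sum (map f (allFin n)) ≡ ∑[ i < n ] f i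
sum-allFin n f = trans (cong sum (map-tabulate id f)) (sum-tabulate n f)
  where
  sum-tabulate : ∀ n (f : Fin n → ℕ) → sum (tabulate f) ≡ ∑[ i < n ] f i
  sum-tabulate zero    f = refl
  sum-tabulate (suc n) f = cong (_+_ (f 0F)) (sum-tabulate n (f ∘ Fin.suc))

sum-cartesianProduct : ∀ (g : A × B → ℕ) xs ys →
  sum (map g (cartesianProduct xs ys)) ≡ sum (map (λ x → sum (map (λ y → g (x , y)) ys)) xs)
sum-cartesianProduct g []       ys = refl
sum-cartesianProduct g (x ∷ xs) ys = begin
  sum (map g (map (x ,_) ys ++ cartesianProduct xs ys))
    ≡⟨ cong sum (map-++ g (map (x ,_) ys) _) ⟩
  sum (map g (map (x ,_) ys) ++ map g (cartesianProduct xs ys))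
    ≡⟨ sum-++ (map g (map (x ,_) ys)) _ ⟩
  sum (map g (map (x ,_) ys)) + sum (map g (cartesianProduct xs ys))
    ≡⟨ cong₂ _+_ (cong sum (sym (map-∘ ys))) (sum-cartesianProduct g xs ys) ⟩
  sum (map (λ y → g (x , y)) ys) + sum (map (λ x → sum (map (λ y → g (x , y)) ys)) xs) ∎
  where open ≡-Reasoning

sum-verts-□ : ∀ (G H : FinGraph) (g : Fin (FinGraph.size G) × Fin (FinGraph.size H) → ℕ) →
  sum (map g (verts (G □ H))) ≡ ∑[ x < FinGraph.size G ] ∑[ y < FinGraph.size H ] g (x , y)
sum-verts-□ G H g = begin
  sum (map g (cartesianProduct (allFin _) (allFin _)))
    ≡⟨ sum-cartesianProduct g (allFin _) (allFin _) ⟩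
  sum (map (λ x → sum (map (λ y → g (x , y)) (allFin _))) (allFin _))
    ≡⟨ sum-allFin (FinGraph.size G) _ ⟩
  ∑[ x < FinGraph.size G ] sum (map (λ y → g (x , y)) (allFin _))
    ≡⟨ sum-cong-≗ {FinGraph.size G} (λ x → sum-allFin (FinGraph.size H) (λ y → g (x , y))) ⟩
  ∑[ x < FinGraph.size G ] ∑[ y < FinGraph.size H ] g (x , y) ∎
  where open ≡-Reasoning

eqℕ≡≡ᵇ : ∀ a b → eqℕ a b ≡ (a ≡ᵇ b)
eqℕ≡≡ᵇ a b = isYes≗does (a ≟ b)

eqFin-refl : ∀ {n} (i : Fin n) → eqFin i i ≡ true
eqFin-refl i = trans (isYes≗does _) (dec-true (toℕ i ≟ toℕ i) refl)

eqFin-punchIn : ∀ {n} (i : Fin (suc n)) j → eqFin i (punchIn i j) ≡ false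
eqFin-punchIn i j = trans (isYes≗does _) (dec-false (toℕ i ≟ _) (punchInᵢ≢i i j ∘ sym ∘ toℕ-injective))

-- The summands are assumed to vanish beyond the range, so the path needs no truncation at its ends.
∑-select : ∀ n j (h : ℕ → ℕ) → (∀ {i} → n ≤ i → h i ≡ 0) →
  ∑[ i < n ] (if j ≡ᵇ toℕ i then h (toℕ i) else 0) ≡ h j
∑-select zero    j       h h₀ = sym (h₀ z≤n)
∑-select (suc n) zero    h h₀ = trans (cong (_+_ (h 0)) (sum-replicate-zero n)) (+-identityʳ (h 0))
∑-select (suc n) (suc j) h h₀ = ∑-select n j (h ∘ suc) (h₀ ∘ s≤s)

∑-select-pred : ∀ n j (h : ℕ → ℕ) → (∀ {i} → n ≤ i → h i ≡ 0) →
  ∑[ i < n ] (if j ≡ᵇ suc (toℕ i) then h (toℕ i) else 0) ≡ (0 ◂ h) j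
∑-select-pred n zero    h h₀ = sum-replicate-zero n
∑-select-pred n (suc j) h h₀ = ∑-select n j h h₀

if-neighbour : ∀ i j x → (if eqℕ i (suc j) ∨ eqℕ j (suc i) then x else 0)
  ≡ (if j ≡ᵇ suc i then x else 0) + (if suc j ≡ᵇ i then x else 0)
if-neighbour i j x rewrite eqℕ≡≡ᵇ i (suc j) | eqℕ≡≡ᵇ j (suc i) = split i j
  where
  split : ∀ i j → (if (i ≡ᵇ suc j) ∨ (j ≡ᵇ suc i) then x else 0)
    ≡ (if j ≡ᵇ suc i then x else 0) + (if suc j ≡ᵇ i then x else 0)
  split zero          zero    = refl
  split zero          (suc j) = sym (+-identityʳ _)
  split (suc zero)    zero    = refl
  split (suc (suc i)) zero    = refl
  split (suc i)       (suc j) = split i j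

∑-neighbours : ∀ n (j : Fin n) (h : ℕ → ℕ) → (∀ {i} → n ≤ i → h i ≡ 0) →
  ∑[ i < n ] (if pathAdj n j i then h (toℕ i) else 0) ≡ (0 ◂ h) (toℕ j) + h (suc (toℕ j))
∑-neighbours n j h h₀ = begin
  ∑[ i < n ] (if pathAdj n j i then h (toℕ i) else 0)
    ≡⟨ sum-cong-≗ {n} (λ i → if-neighbour (toℕ i) (toℕ j) (h (toℕ i))) ⟩
  ∑[ i < n ] ((if toℕ j ≡ᵇ suc (toℕ i) then h (toℕ i) else 0) + (if suc (toℕ j) ≡ᵇ toℕ i then h (toℕ i) else 0))
    ≡⟨ ∑-distrib-+ {n} _ _ ⟩
  ∑[ i < n ] (if toℕ j ≡ᵇ suc (toℕ i) then h (toℕ i) else 0) + ∑[ i < n ] (if suc (toℕ j) ≡ᵇ toℕ i then h (toℕ i) else 0)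
    ≡⟨ cong₂ _+_ (∑-select-pred n (toℕ j) h h₀) (∑-select n (suc (toℕ j)) h h₀) ⟩
  (0 ◂ h) (toℕ j) + h (suc (toℕ j)) ∎
  where open ≡-Reasoning

C₃□P : ℕ → Graph
C₃□P n = Cf 3 □ Pf n

adj-C₃□P : ∀ n q q' (j j' : Fin n) →
  adj (C₃□P n) (q , j) (q' , j') ≡ (if eqFin q q' then pathAdj n j j' else eqFin j j')
adj-C₃□P n 0F 0F j j' = refl
adj-C₃□P n 0F 1F j j' = ∨-identityʳ _
adj-C₃□P n 0F 2F j j' = ∨-identityʳ _
adj-C₃□P n 1F 0F j j' = ∨-identityʳ _
adj-C₃□P n 1F 1F j j' = refl
adj-C₃□P n 1F 2F j j' = ∨-identityʳ _
adj-C₃□P n 2F 0F j j' = ∨-identityʳ _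
adj-C₃□P n 2F 1F j j' = ∨-identityʳ _
adj-C₃□P n 2F 2F j j' = refl

Column : Set
Column = Fin 3 → ℕ

Strip : Set
Strip = ℕ → Column

zeros : Column
zeros _ = 0

onVertices : ∀ {n} → Strip → Fin 3 × Fin n → ℕ
onVertices s (q , j) = s (toℕ j) q

VanishesFrom : ℕ → Strip → Set
VanishesFrom n s = ∀ {j} → n ≤ j → ∀ q → s j q ≡ 0

◂-row : ∀ (s : Strip) q j → (0 ◂ λ i → s i q) j ≡ (zeros ◂ s) j q
◂-row s q zero    = refl
◂-row s q (suc j) = refl

sumWhere-C₃□P : ∀ n s → VanishesFrom n s → ∀ q (j : Fin n) →
  sumWhere (C₃□P n) (adj (C₃□P n) (q , j)) (onVertices s)
    ≡ ((zeros ◂ s) (toℕ j) q + s (suc (toℕ j)) q) + ∑[ r < 2 ] s (toℕ j) (punchIn q r)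
sumWhere-C₃□P n s s₀ q j = begin
  sumWhere (C₃□P n) (adj (C₃□P n) (q , j)) (onVertices s)
    ≡⟨ sum-verts-□ (Cf 3) (Pf n) _ ⟩
  ∑[ q' < 3 ] row q'
    ≡⟨ sum-remove {i = q} row ⟩
  row q + ∑[ r < 2 ] row (punchIn q r)
    ≡⟨ cong₂ _+_ own-row (sum-cong-≗ {2} other-row) ⟩
  ((zeros ◂ s) (toℕ j) q + s (suc (toℕ j)) q) + ∑[ r < 2 ] s (toℕ j) (punchIn q r) ∎
  where
  open ≡-Reasoning
  row : Fin 3 → ℕ
  row q' = ∑[ j' < n ] (if adj (C₃□P n) (q , j) (q' , j') then s (toℕ j') q' else 0)

  summand-cong : ∀ q' j' b → adj (C₃□P n) (q , j) (q' , j') ≡ b →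
    (if adj (C₃□P n) (q , j) (q' , j') then s (toℕ j') q' else 0) ≡ (if b then s (toℕ j') q' else 0)
  summand-cong q' j' b eq = cong (λ b → if b then s (toℕ j') q' else 0) eq

  own-row : row q ≡ (zeros ◂ s) (toℕ j) q + s (suc (toℕ j)) q
  own-row = begin
    row q
      ≡⟨ sum-cong-≗ {n} (λ j' → summand-cong q j' _ (trans (adj-C₃□P n q q j j') (cong (if_then _ else _) (eqFin-refl q)))) ⟩
    ∑[ j' < n ] (if pathAdj n j j' then s (toℕ j') q else 0)
      ≡⟨ ∑-neighbours n j (λ i → s i q) (λ n≤i → s₀ n≤i q) ⟩
    (0 ◂ λ i → s i q) (toℕ j) + s (suc (toℕ j)) q
      ≡⟨ cong (_+ s (suc (toℕ j)) q) (◂-row s q (toℕ j)) ⟩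
    (zeros ◂ s) (toℕ j) q + s (suc (toℕ j)) q ∎

  other-row : ∀ r → row (punchIn q r) ≡ s (toℕ j) (punchIn q r)
  other-row r = begin
    row (punchIn q r)
      ≡⟨ sum-cong-≗ {n} (λ j' → summand-cong q' j' _ (trans (adj-C₃□P n q q' j j') (cong (if_then _ else _) (eqFin-punchIn q r)))) ⟩
    ∑[ j' < n ] (if eqFin j j' then s (toℕ j') q' else 0)
      ≡⟨ sum-cong-≗ {n} (λ j' → cong (λ b → if b then s (toℕ j') q' else 0) (eqℕ≡≡ᵇ (toℕ j) (toℕ j'))) ⟩
    ∑[ j' < n ] (if toℕ j ≡ᵇ toℕ j' then s (toℕ j') q' else 0)
      ≡⟨ ∑-select n (toℕ j) (λ i → s i q') (λ n≤i → s₀ n≤i q') ⟩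
    s (toℕ j) q' ∎
    where q' = punchIn q r

sgn : ℕ → ℕ
sgn zero    = 0
sgn (suc _) = 1

sgnStrip : Strip → Strip
sgnStrip s j q = sgn (s j q)

◂-sgnStrip : ∀ s j q → (zeros ◂ sgnStrip s) j q ≡ sgn ((zeros ◂ s) j q)
◂-sgnStrip s zero    q = refl
◂-sgnStrip s (suc j) q = refl

activeNbrs≡sumWhere-sgn : ∀ (G : Graph) f v → activeNbrs G f v ≡ sumWhere G (adj G v) (sgn ∘ f)
activeNbrs≡sumWhere-sgn G f v = cong sum (map-cong (λ u → if-∧-nonzero (adj G v u) (f u)) (verts G))
  where
  if-∧-nonzero : ∀ b x → (if b ∧ not (eqℕ x 0) then 1 else 0) ≡ (if b then sgn x else 0)
  if-∧-nonzero false x       = refl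
  if-∧-nonzero true  zero    = refl
  if-∧-nonzero true  (suc x) = refl

-- f(N[v]) and |AN(v)| for v in row q of the column c, when the same row of the columns to the
-- left and right carries l q and r q; punchIn q enumerates the two other rows of the column.
RomanAt : ℕ → (l c r : Column) → Fin 3 → Set
RomanAt k l c r q = c q < k →
  k + ((sgn (l q) + sgn (r q)) + ∑[ i < 2 ] sgn (c (punchIn q i)))
    ≤ c q + ((l q + r q) + ∑[ i < 2 ] c (punchIn q i))

RomanWindow : ℕ → (l c r : Column) → Set
RomanWindow k l c r = ∀ q → RomanAt k l c r q

romanWindow? : ∀ k l c r → Dec (RomanWindow k l c r)
romanWindow? k l c r = all? λ q → (c q <? k) →-dec (_ ≤? _)

RomanFrom : ℕ → Column → Strip → ℕ → Set
RomanFrom k l s n = ∀ j → j < n → RomanWindow k ((l ◂ s) j) (s j) (s (suc j))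

Bounded : ℕ → Strip → Set
Bounded K s = ∀ j q → s j q ≤ K

isKRDF-onVertices : ∀ {k} n s → VanishesFrom n s → Bounded (suc k) s → RomanFrom k zeros s n →
  IsKRDF (C₃□P n) k (onVertices s)
isKRDF-onVertices {k} n s s₀ bounded roman = (λ (q , j) → bounded (toℕ j) q) , romanAt
  where
  romanAt : ∀ v → onVertices s v < k →
    k + activeNbrs (C₃□P n) (onVertices s) v ≤ fClosedNbhd (C₃□P n) (onVertices s) v
  romanAt (q , j) =
    subst₂ (λ a b → k + a ≤ s J q + b) (sym active) (sym (sumWhere-C₃□P n s s₀ q j)) ∘ roman J (toℕ<n j) q
    where
    J = toℕ j
    active : activeNbrs (C₃□P n) (onVertices s) (q , j)
      ≡ (sgn ((zeros ◂ s) J q) + sgn (s (suc J) q)) + ∑[ i < 2 ] sgn (s J (punchIn q i))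
    active = begin
      activeNbrs (C₃□P n) (onVertices s) (q , j)
        ≡⟨ activeNbrs≡sumWhere-sgn (C₃□P n) (onVertices s) (q , j) ⟩
      sumWhere (C₃□P n) (adj (C₃□P n) (q , j)) (onVertices (sgnStrip s))
        ≡⟨ sumWhere-C₃□P n (sgnStrip s) (λ n≤j q → cong sgn (s₀ n≤j q)) q j ⟩
      ((zeros ◂ sgnStrip s) J q + sgn (s (suc J) q)) + ∑[ i < 2 ] sgn (s J (punchIn q i))
        ≡⟨ cong (λ a → (a + sgn (s (suc J) q)) + ∑[ i < 2 ] sgn (s J (punchIn q i))) (◂-sgnStrip s J q) ⟩
      (sgn ((zeros ◂ s) J q) + sgn (s (suc J) q)) + ∑[ i < 2 ] sgn (s J (punchIn q i)) ∎
      where open ≡-Reasoning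

total : Column → ℕ
total c = ∑[ q < 3 ] c q

weight-onVertices : ∀ n s → weight (C₃□P n) (onVertices s) ≡ ∑[ j < n ] total (s (toℕ j))
weight-onVertices n s = trans (sum-verts-□ (Cf 3) (Pf n) (onVertices s)) (∑-comm {3} {n} (λ q j → s (toℕ j) q))

GammaKR≤-mono : ∀ G k {a b} → GammaKR≤ G k a → a Z.≤ b → GammaKR≤ G k b
GammaKR≤-mono G k (f , f-krdf , w≤a) a≤b = f , f-krdf , Z.≤-trans w≤a a≤b

vanishesFrom-◂ : ∀ {n c s} → VanishesFrom n s → VanishesFrom (suc n) (c ◂ s)
vanishesFrom-◂ s₀ {suc j} (s≤s n≤j) = s₀ n≤j

bounded-◂ : ∀ {K c s} → (∀ q → c q ≤ K) → Bounded K s → Bounded K (c ◂ s)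
bounded-◂ c≤K s≤K zero    = c≤K
bounded-◂ c≤K s≤K (suc j) = s≤K j

romanFrom-◂ : ∀ {k l c s n} → RomanWindow k l c (s 0) → RomanFrom k c s n → RomanFrom k l (c ◂ s) (suc n)
romanFrom-◂ window rest zero    _         = window
romanFrom-◂ window rest (suc j) (s≤s j<n) = rest j j<n

next : Fin 3 → Fin 3
next 0F = 1F
next 1F = 2F
next 2F = 0F

record PeriodicPattern (k : ℕ) (first : Column) (mid last : Fin 3 → Column) : Set where
  field
    first-bounded      : ∀ q → first q ≤ suc k
    mid-bounded        : ∀ p q → mid p q ≤ suc k
    last-bounded       : ∀ p q → last p q ≤ suc k
    first-window       : RomanWindow k zeros first (mid 1F)
    second-window      : RomanWindow k first (mid 1F) (mid 2F)
    mid-window         : ∀ p → RomanWindow k (mid p) (mid (next p)) (mid (next (next p)))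
    penultimate-window : ∀ p → RomanWindow k (mid p) (mid (next p)) (last (next (next p)))
    last-window        : ∀ p → RomanWindow k (mid p) (last (next p)) zeros

periodicPattern? : ∀ k first mid last → Dec (PeriodicPattern k first mid last)
periodicPattern? k first mid last = map′
  (λ (b₁ , b₂ , b₃ , w₁ , w₂ , w₃ , w₄ , w₅) → record
    { first-bounded = b₁ ; mid-bounded = b₂ ; last-bounded = b₃
    ; first-window = w₁ ; second-window = w₂ ; mid-window = w₃
    ; penultimate-window = w₄ ; last-window = w₅ })
  (λ P → let open PeriodicPattern P in
    first-bounded , mid-bounded , last-bounded , first-window , second-window ,
    mid-window , penultimate-window , last-window)
  (all? (λ q → first q ≤? suc k) ×-dec
   all? (λ p → all? λ q → mid p q ≤? suc k) ×-dec
   all? (λ p → all? λ q → last p q ≤? suc k) ×-dec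
   romanWindow? k zeros first (mid 1F) ×-dec
   romanWindow? k first (mid 1F) (mid 2F) ×-dec
   all? (λ p → romanWindow? k (mid p) (mid (next p)) (mid (next (next p)))) ×-dec
   all? (λ p → romanWindow? k (mid p) (mid (next p)) (last (next (next p)))) ×-dec
   all? (λ p → romanWindow? k (mid p) (last (next p)) zeros))

module _ (first : Column) (mid last : Fin 3 → Column) where

  run : Fin 3 → ℕ → Strip
  run p zero    = last p ◂ λ _ → zeros
  run p (suc m) = mid p ◂ run (next p) m

  strip : ℕ → Strip
  strip m = first ◂ run 1F m

  run-vanishes : ∀ p m → VanishesFrom (suc m) (run p m)
  run-vanishes p zero    = vanishesFrom-◂ λ _ _ → refl
  run-vanishes p (suc m) = vanishesFrom-◂ (run-vanishes (next p) m)

  run-total : ∀ {a b} → (∀ p → total (mid p) ≡ a) → (∀ p → total (last p) ≡ b) →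
    ∀ p m → ∑[ j < suc m ] total (run p m (toℕ j)) ≡ m * a + b
  run-total mid-total last-total p zero    = trans (+-identityʳ _) (last-total p)
  run-total {a} {b} mid-total last-total p (suc m) =
    trans (cong₂ _+_ (mid-total p) (run-total mid-total last-total (next p) m)) (sym (+-assoc a (m * a) b))

  strip-weight : ∀ {a b} → (∀ p → total (mid p) ≡ a) → (∀ p → total (last p) ≡ b) → ∀ m →
    weight (C₃□P (2 + m)) (onVertices (strip m)) ≡ total first + (m * a + b)
  strip-weight mid-total last-total m =
    trans (weight-onVertices (2 + m) (strip m)) (cong (_+_ (total first)) (run-total mid-total last-total 1F m))

  module _ {k} (P : PeriodicPattern k first mid last) where
    open PeriodicPattern P

    run-bounded : ∀ p m → Bounded (suc k) (run p m)
    run-bounded p zero    = bounded-◂ (last-bounded p) λ _ _ → z≤n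
    run-bounded p (suc m) = bounded-◂ (mid-bounded p) (run-bounded (next p) m)

    run-roman : ∀ p m → RomanFrom k (mid p) (run (next p) m) (suc m)
    run-roman p zero          = romanFrom-◂ (last-window p) λ _ ()
    run-roman p (suc zero)    = romanFrom-◂ (penultimate-window p) (run-roman (next p) zero)
    run-roman p (suc (suc m)) = romanFrom-◂ (mid-window p) (run-roman (next p) (suc m))

    strip-isKRDF : ∀ m → IsKRDF (C₃□P (4 + m)) k (onVertices (strip (2 + m)))
    strip-isKRDF m = isKRDF-onVertices (4 + m) (strip (2 + m))
      (vanishesFrom-◂ (run-vanishes 1F (2 + m)))
      (bounded-◂ first-bounded (run-bounded 1F (2 + m)))
      (romanFrom-◂ first-window (romanFrom-◂ second-window (run-roman 1F (suc m))))

    γ-strip : ∀ {a b} → (∀ p → total (mid p) ≡ a) → (∀ p → total (last p) ≡ b) → ∀ m →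
      GammaKR≤ (C₃□P (4 + m)) k (+ (total first + ((2 + m) * a + b)))
    γ-strip mid-total last-total m =
      onVertices (strip (2 + m)) , strip-isKRDF m ,
      Z.≤-reflexive (cong +_ (strip-weight mid-total last-total (2 + m)))

hole : ℕ → Fin 3 → Column
hole x p q = if eqFin p q then 0 else x

edge : ℕ → ℕ → Fin 3 → Column
edge a b p q = if eqFin q p then 0 else if eqFin q (next p) then a else b

total-hole : ∀ x p → total (hole x p) ≡ x + x
total-hole x 0F = cong (_+_ x) (+-identityʳ x)
total-hole x 1F = cong (_+_ x) (+-identityʳ x)
total-hole x 2F = cong (_+_ x) (+-identityʳ x)

total-edge : ∀ a b p → total (edge a b p) ≡ a + b
total-edge a b 0F = cong (_+_ a) (+-identityʳ b)
total-edge a b 1F = trans (cong (_+_ b) (+-identityʳ a)) (+-comm b a)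
total-edge a b 2F = cong (_+_ a) (+-identityʳ b)

Admissible : (k A e₁ e₂ b c : ℕ) → Set
Admissible k A e₁ e₂ b c =
  PeriodicPattern k (edge e₁ e₂ 0F) (hole A) (edge e₂ e₁) ×
  2 * (e₁ + e₂) ≤ b + c × 4 * A ≤ k + 8 × 2 * (b + c) ≤ 4 * k + 28

admissible? : ∀ k A e₁ e₂ b c → Dec (Admissible k A e₁ e₂ b c)
admissible? k A e₁ e₂ b c =
  periodicPattern? k (edge e₁ e₂ 0F) (hole A) (edge e₂ e₁) ×-dec
  2 * (e₁ + e₂) ≤? b + c ×-dec 4 * A ≤? k + 8 ×-dec 2 * (b + c) ≤? 4 * k + 28

admissible⇒bound : ∀ {k A e₁ e₂ b c} → Admissible k A e₁ e₂ b c → ∀ m →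
  GammaKR≤ (C₃□P (4 + m)) k (+ (2 * (2 + m) * A + b + c))
  × (+ 2) Z.* (+ (2 * (2 + m) * A + b + c)) Z.≤ + ((4 + m) * k + 2 * k + 8 * (4 + m) + 12)
admissible⇒bound {k} {A} {e₁} {e₂} {b} {c} (P , ends≤ , hole≤ , ends-bound) m =
  GammaKR≤-mono (C₃□P (4 + m)) k
    (γ-strip (edge e₁ e₂ 0F) (hole A) (edge e₂ e₁) P (total-hole A) (total-edge e₂ e₁) m)
    (Z.+≤+ weight≤) ,
  subst (Z._≤ _) (Z.pos-* 2 (2 * M * A + b + c)) (Z.+≤+ twice≤)
  where
  M = 2 + m
  weight≤ : total (edge e₁ e₂ 0F) + (M * (A + A) + (e₂ + e₁)) ≤ 2 * M * A + b + c
  weight≤ = begin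
    total (edge e₁ e₂ 0F) + (M * (A + A) + (e₂ + e₁))
      ≡⟨ cong (λ t → t + (M * (A + A) + (e₂ + e₁))) (total-edge e₁ e₂ 0F) ⟩
    (e₁ + e₂) + (M * (A + A) + (e₂ + e₁))
      ≡⟨ regroup e₁ e₂ M A ⟩
    2 * M * A + 2 * (e₁ + e₂)
      ≤⟨ +-monoʳ-≤ (2 * M * A) ends≤ ⟩
    2 * M * A + (b + c)
      ≡⟨ +-assoc (2 * M * A) b c ⟨
    2 * M * A + b + c ∎
    where
    open ≤-Reasoning
    regroup : ∀ e₁ e₂ M A → (e₁ + e₂) + (M * (A + A) + (e₂ + e₁)) ≡ 2 * M * A + 2 * (e₁ + e₂)
    regroup = solve-∀
  twice≤ : 2 * (2 * M * A + b + c) ≤ (2 + M) * k + 2 * k + 8 * (2 + M) + 12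
  twice≤ = subst₂ _≤_ (expand-left M A b c) (expand-right M k) (+-mono-≤ (*-monoʳ-≤ M hole≤) ends-bound)
    where
    expand-left : ∀ M A b c → M * (4 * A) + 2 * (b + c) ≡ 2 * (2 * M * A + b + c)
    expand-left = solve-∀
    expand-right : ∀ M k → M * (k + 8) + (4 * k + 28) ≡ (2 + M) * k + 2 * k + 8 * (2 + M) + 12
    expand-right = solve-∀

pattern 4≤4+ m = s≤s (s≤s (s≤s (s≤s (z≤n {m}))))

mainTheorem14 : (n k : ℕ) → 4 ≤ n → 1 ≤ k → k ≤ 13 →
    k ≢ 1 → k ≢ 8 → k ≢ 11 → k ≢ 12 →
    let A = ceilDiv (k + 4) 4
        B = ceilDiv (3 * A ∸ 2) 2
        Cz = (+ (k + 4)) - (+ (3 * A))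
        bnd = (+ (2 * (n ∸ 2) * A + 4 * B)) Z.+ (+ 2) Z.* Cz
    in GammaKR≤ (Cf 3 □ Pf n) k bnd
       × (+ 2) Z.* bnd Z.≤ + (n * k + 2 * k + 8 * n + 12)
-- The arguments of admissible? are k, A, e₁, e₂, 4B and 2C.
mainTheorem14 _ 2  (4≤4+ m) _ _ _ _ _ _ = admissible⇒bound (from-yes (admissible? 2 2 0 3 8 0)) m
mainTheorem14 _ 3  (4≤4+ m) _ _ _ _ _ _ = admissible⇒bound (from-yes (admissible? 3 2 0 4 8 2)) m
mainTheorem14 _ 4  (4≤4+ m) _ _ _ _ _ _ = admissible⇒bound (from-yes (admissible? 4 2 2 3 8 4)) m
mainTheorem14 _ 5  (4≤4+ m) _ _ _ _ _ _ = admissible⇒bound (from-yes (admissible? 5 3 0 6 16 0)) m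
mainTheorem14 _ 6  (4≤4+ m) _ _ _ _ _ _ = admissible⇒bound (from-yes (admissible? 6 3 0 7 16 2)) m
mainTheorem14 _ 7  (4≤4+ m) _ _ _ _ _ _ = admissible⇒bound (from-yes (admissible? 7 3 2 6 16 4)) m
mainTheorem14 _ 9  (4≤4+ m) _ _ _ _ _ _ = admissible⇒bound (from-yes (admissible? 9 4 0 10 20 2)) m
mainTheorem14 _ 10 (4≤4+ m) _ _ _ _ _ _ = admissible⇒bound (from-yes (admissible? 10 4 2 9 20 4)) m
mainTheorem14 _ 13 (4≤4+ m) _ _ _ _ _ _ = admissible⇒bound (from-yes (admissible? 13 5 2 12 28 4)) m
mainTheorem14 _ 0  _ () _ _ _ _ _
mainTheorem14 _ 1  _ _ _ k≢1 _ _ _  = contradiction refl k≢1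
mainTheorem14 _ 8  _ _ _ _ k≢8 _ _  = contradiction refl k≢8
mainTheorem14 _ 11 _ _ _ _ _ k≢11 _ = contradiction refl k≢11
mainTheorem14 _ 12 _ _ _ _ _ _ k≢12 = contradiction refl k≢12
mainTheorem14 _ (suc (suc (suc (suc (suc (suc (suc (suc (suc (suc (suc (suc (suc (suc _)))))))))))))) _ _ k≤13 _ _ _ _ =
  contradiction (m+n≤o⇒m≤o 14 k≤13) (n≮n 13)
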